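{- If $G$ is a co-comparability graph with at least two vertices, then $\mathrm{thin}(G)\leq |V(G)|/2$.
   Context: Graphs are finite, simple, undirected. A graph $H$ is a comparability graph if there is an ordering $v_1,\dots,v_n$ of $V(H)$ such that for each $r<s<t$, if $v_rv_s$ and $v_sv_t$ are edges then $v_rv_t$ is an edge; $G$ is a co-comparability graph if its complement is a comparability graph. For a graph $G=(V,E)$, an ordering $v_1,\dots,v_n$ of $V$ and a partition of $V$ are consistent if for every $r<s<t$, whenever $v_r,v_s$ are in the same class and $v_tv_r\in E$, then $v_tv_s\in E$. $\mathrm{thin}(G)$ is the minimum number of classes of a partition of $V$ consistent with some ordering of $V$. -}

module Defs where

open import Data.Nat using (ℕ; _≤_; _*_; _<_)
open import Data.Fin using (Fin; toℕ)
open import Data.Bool using (Bool; true; false)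
open import Data.Product using (Σ; _×_; ∃)
open import Relation.Binary.PropositionalEquality using (_≡_; _≢_)
open import Function.Bundles using (_↔_; Inverse)

record Graph (n : ℕ) : Set where
  field
    adj   : Fin n → Fin n → Bool
    adj-sym : ∀ u v → adj u v ≡ adj v u
    adj-irrefl : ∀ v → adj v v ≡ false

open Graph public

Edge : ∀ {n} → Graph n → Fin n → Fin n → Set
Edge G u v = adj G u v ≡ true

-- An ordering v_1,…,v_n of the vertices: a bijection from positions to vertices.
Ordering : ℕ → Set
Ordering n = Fin n ↔ Fin n

at : ∀ {n} → Ordering n → Fin n → Fin n
at σ = Inverse.to σ

complement : ∀ {n} → Graph n → Graph n
complement {n} G = record { adj = cadj ; adj-sym = csym ; adj-irrefl = cirr }
  where
  open import Data.Fin using (_≟_)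
  open import Relation.Nullary using (yes; no)
  open import Data.Bool using (not)
  open import Relation.Binary.PropositionalEquality using (refl; sym; cong)
  cadj : Fin n → Fin n → Bool
  cadj u v with u ≟ v
  ... | yes _ = false
  ... | no _  = not (adj G u v)
  csym : ∀ u v → cadj u v ≡ cadj v u
  csym u v with u ≟ v | v ≟ u
  ... | yes _ | yes _ = refl
  ... | yes p | no q = Data.Empty.⊥-elim (q (sym p))
    where import Data.Empty
  ... | no p | yes q = Data.Empty.⊥-elim (p (sym q))
    where import Data.Empty
  ... | no _ | no _ = cong not (Graph.adj-sym G u v)
  cirr : ∀ v → cadj v v ≡ false
  cirr v with v ≟ v
  ... | yes _ = refl
  ... | no p = Data.Empty.⊥-elim (p refl)
    where import Data.Empty

IsComparability : ∀ {n} → Graph n → Set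
IsComparability {n} H =
  Σ (Ordering n) λ σ → ∀ (r s t : Fin n) → toℕ r < toℕ s → toℕ s < toℕ t →
    Edge H (at σ r) (at σ s) → Edge H (at σ s) (at σ t) → Edge H (at σ r) (at σ t)

IsCoComparability : ∀ {n} → Graph n → Set
IsCoComparability G = IsComparability (complement G)

-- A partition of the vertices into (at most) k classes, given by a class label.
Partition : ℕ → ℕ → Set
Partition n k = Fin n → Fin k

Consistent : ∀ {n k} → Graph n → Ordering n → Partition n k → Set
Consistent {n} G σ P = ∀ (r s t : Fin n) → toℕ r < toℕ s → toℕ s < toℕ t →
  P (at σ r) ≡ P (at σ s) → Edge G (at σ t) (at σ r) → Edge G (at σ t) (at σ s)

ThinLe : ∀ {n} → Graph n → ℕ → Set
ThinLe {n} G k = Σ (Ordering n) λ σ → Σ (Partition n k) λ P → Consistent G σ P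

-- Let σ order the vertices so that non-adjacency, read left to right, is transitive; then
-- positions i < j with v_i v_j ∉ E form a partial order ≺. Take k = ⌊n/2⌋ and apply Dilworth's
-- theorem (proved by Galvin's induction on a maximal element) to ≺.
-- If the positions split into k chains, σ with the chains as classes is consistent: for r < s < t
-- with v_r, v_s in one chain and v_t v_r ∈ E, v_t v_s ∉ E would give r ≺ s ≺ t, hence v_t v_r ∉ E.
-- Otherwise there is an antichain of size k + 1, i.e. a clique C of G with |C| > n/2. Pick b ∉ C
-- and order the vertices as: those outside C ∪ {b}, the non-neighbours of b in C, the neighbours
-- of b in C, then b. Each vertex outside C ∪ {b} is a class of its own and C ∪ {b} is one class;
-- this is consistent and uses n − |C| ≤ k classes.

module Submission where

open import Defs
open import Level using (0ℓ)
open import Data.Nat as ℕ using (ℕ; zero; suc; _+_; _*_; _∸_; _≤_; _<_; z≤n; s≤s; s≤s⁻¹; ⌊_/2⌋; ⌈_/2⌉)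
open import Data.Nat.Properties
  using ( ≤-refl; ≤-trans; <-trans; <-irrefl; <-asym; <-cmp; <⇒≤; <⇒≱; ≰⇒>; ≤-<-trans; m<n⇒m<1+n
        ; suc-injective; 1+n≢0; n≤0⇒n≡0; +-suc; +-comm; +-identityʳ; +-monoʳ-≤
        ; m+n≤o⇒m≤o∸n; m≤n+o⇒m∸n≤o; m<n⇒0<n∸m
        ; ⌊n/2⌋≤⌈n/2⌉; ⌊n/2⌋+⌈n/2⌉≡n; ⌊n/2⌋<n; ≤-decTotalOrder; module ≤-Reasoning )
open import Data.Bool using (true; false; if_then_else_)
import Data.Bool as Bool
open import Data.Bool.Properties using (¬-not; not-¬)
open import Data.Fin as Fin using (Fin; toℕ; fromℕ<; inject≤; punchOut; cast)
open import Data.Fin.Properties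
  using ( toℕ<n; toℕ-injective; toℕ-fromℕ<; toℕ-inject≤; toℕ-cast; inject≤-injective
        ; punchOut-injective; cast-involutive; injective⇒≤; any? )
open import Data.Fin.Permutation as Permutation using (cast-id; _∘ₚ_)
open import Data.List using (List; []; _∷_; length; lookup; filter; tabulate; allFin; map; _++_)
open import Data.List.Properties
  using (length-filter; filter-notAll; length-tabulate; lookup-tabulate; length-++; length-map)
open import Data.List.Extrema.Nat using (argmax; argmax-all; f[xs]≤f[argmax])
import Data.List.Sort as Sort
open import Data.List.Relation.Unary.Sorted.TotalOrder.Properties using (lookup-mono-≤)
open import Data.List.Relation.Binary.Permutation.Propositional using (↭⇒↭ₛ)
open import Data.List.Relation.Binary.Permutation.Propositional.Properties using (↭-length)
open import Data.List.Relation.Binary.Permutation.Setoid using (onIndices)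
open import Data.List.Relation.Binary.Permutation.Setoid.Properties using (onIndices-lookup)
open import Data.List.Relation.Binary.Subset.Propositional using (_⊆_)
open import Data.List.Relation.Unary.All as All using (All; []; _∷_)
open import Data.List.Relation.Unary.All.Properties using (¬Any⇒All¬; tabulate⁺)
open import Data.List.Relation.Unary.Any as Any using (Any; here; there)
open import Data.List.Relation.Unary.Any.Properties using (lookup-index)
open import Data.List.Relation.Unary.AllPairs as AllPairs using (AllPairs; []; _∷_)
import Data.List.Relation.Unary.AllPairs.Properties as AllPairs
open import Data.List.Membership.Propositional using (_∈_; _∉_; find)
open import Data.List.Membership.Propositional.Properties
  using (∈-lookup; ∈-filter⁺; ∈-filter⁻; ∈-tabulate⁻; ∈-allFin)
open import Data.Product using (Σ; _×_; _,_; proj₁; proj₂; ∃)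
open import Data.Sum as Sum using (_⊎_; inj₁; inj₂)
open import Function using (id; _∘′_)
open import Function.Bundles using (Inverse)
open import Relation.Binary.Core using (Rel)
open import Relation.Binary.Definitions
  using (Decidable; DecidableEquality; Transitive; Symmetric; tri<; tri≈; tri>)
open import Relation.Binary.Bundles using (DecTotalOrder)
import Relation.Binary.Construct.On as On
open import Relation.Binary.PropositionalEquality
open import Relation.Nullary using (¬_; Dec; yes; no; contradiction)
open import Relation.Nullary.Decidable using (map′; _×-dec_; _⊎-dec_; decidable-stable)
import Relation.Unary
open import Relation.Unary.Properties using (∁?)

module _ {B : Set} (f : B → ℕ) where

  lookup-injective : ∀ {xs} → AllPairs (λ x y → f x ≢ f y) xs →
    ∀ {i j} → f (lookup xs i) ≡ f (lookup xs j) → i ≡ j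
  lookup-injective (_ ∷ _) {Fin.zero} {Fin.zero} _ = refl
  lookup-injective (px ∷ _) {Fin.zero} {Fin.suc j} eq = contradiction eq (All.lookup px (∈-lookup j))
  lookup-injective (px ∷ _) {Fin.suc i} {Fin.zero} eq = contradiction (sym eq) (All.lookup px (∈-lookup i))
  lookup-injective (_ ∷ pxs) {Fin.suc i} {Fin.suc j} eq = cong Fin.suc (lookup-injective pxs eq)

  distinct-values⇒length≤ : ∀ {m xs} → All (λ x → f x < m) xs →
    AllPairs (λ x y → f x ≢ f y) xs → length xs ≤ m
  distinct-values⇒length≤ {xs = xs} bounded distinct = injective⇒≤ value-injective
    where
    value : Fin (length xs) → Fin _
    value i = fromℕ< (All.lookup bounded (∈-lookup i))
    value-injective : ∀ {i j} → value i ≡ value j → i ≡ j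
    value-injective eq = lookup-injective distinct
      (trans (sym (toℕ-fromℕ< _)) (trans (cong toℕ eq) (toℕ-fromℕ< _)))

  -- If value i were missed, punching it out would inject xs into Fin (m ∸ 1).
  distinct-values-exhaustive : ∀ {m xs} → length xs ≡ m → All (λ x → f x < m) xs →
    AllPairs (λ x y → f x ≢ f y) xs → (i : Fin m) → Any (λ x → f x ≡ toℕ i) xs
  distinct-values-exhaustive {suc m} {xs} len bounded distinct i
    with Any.any? (λ x → f x ℕ.≟ toℕ i) xs
  ... | yes hit = hit
  ... | no miss = contradiction (s≤s (injective⇒≤ punched-injective)) (<-irrefl len)
    where
    avoids : ∀ k → i ≢ fromℕ< (All.lookup bounded (∈-lookup k))
    avoids k eq = All.lookup (¬Any⇒All¬ xs miss) (∈-lookup k)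
      (trans (sym (toℕ-fromℕ< _)) (cong toℕ (sym eq)))
    punched : Fin (length xs) → Fin m
    punched k = punchOut (avoids k)
    punched-injective : ∀ {k l} → punched k ≡ punched l → k ≡ l
    punched-injective eq = lookup-injective distinct
      (trans (sym (toℕ-fromℕ< _)) (trans (cong toℕ (punchOut-injective (avoids _) (avoids _) eq)) (toℕ-fromℕ< _)))

module _ {B : Set} {R : Rel B 0ℓ} where

  AllPairs-∈ : Symmetric R → ∀ {xs x y} → AllPairs R xs → x ∈ xs → y ∈ xs → x ≢ y → R x y
  AllPairs-∈ R-sym (_ ∷ _) (here refl) (here refl) x≢y = contradiction refl x≢y
  AllPairs-∈ R-sym (px ∷ _) (here refl) (there y∈) _ = All.lookup px y∈
  AllPairs-∈ R-sym (px ∷ _) (there x∈) (here refl) _ = R-sym (All.lookup px x∈)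
  AllPairs-∈ R-sym (_ ∷ pxs) (there x∈) (there y∈) x≢y = AllPairs-∈ R-sym pxs x∈ y∈ x≢y

  AllPairs-map∈ : ∀ {R′ : Rel B 0ℓ} {xs} → (∀ {x y} → x ∈ xs → y ∈ xs → R x y → R′ x y) →
    AllPairs R xs → AllPairs R′ xs
  AllPairs-map∈ f [] = []
  AllPairs-map∈ f (px ∷ pxs) =
    All.tabulate (λ y∈ → f (here refl) (there y∈) (All.lookup px y∈)) ∷
    AllPairs-map∈ (λ x∈ y∈ → f (there x∈) (there y∈)) pxs

  AllPairs-remove : Symmetric R → ∀ {z xs} → z ∈ xs → AllPairs R xs →
    ∃ λ ys → suc (length ys) ≡ length xs × ys ⊆ xs × AllPairs R ys × All (R z) ys
  AllPairs-remove R-sym (here refl) (pz ∷ pxs) = _ , refl , there , pxs , pz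
  AllPairs-remove R-sym {xs = x ∷ _} (there z∈) (px ∷ pxs)
    with ys , len , ys⊆ , pys , pzys ← AllPairs-remove R-sym z∈ pxs =
      x ∷ ys , cong suc len , ⊆-cons , All.tabulate (All.lookup px ∘′ ys⊆) ∷ pys ,
      R-sym (All.lookup px z∈) ∷ pzys
    where
    ⊆-cons : x ∷ ys ⊆ x ∷ _
    ⊆-cons (here refl) = here refl
    ⊆-cons (there y∈) = there (ys⊆ y∈)

-- Dilworth's theorem

module Dilworth {A : Set} (_≟_ : DecidableEquality A)
  {_≺_ : Rel A 0ℓ} (_≺?_ : Decidable _≺_) (≺-trans : Transitive _≺_)
  (rank : A → ℕ) (≺⇒rank< : ∀ {x y} → x ≺ y → rank x < rank y) where

  open import Data.List.Membership.DecPropositional _≟_ using (_∈?_)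

  _≼_ : Rel A 0ℓ
  x ≼ y = x ≡ y ⊎ x ≺ y

  ≼-≺-trans : ∀ {x y z} → x ≼ y → y ≺ z → x ≺ z
  ≼-≺-trans (inj₁ refl) y≺z = y≺z
  ≼-≺-trans (inj₂ x≺y) y≺z = ≺-trans x≺y y≺z

  Comparable : Rel A 0ℓ
  Comparable x y = x ≡ y ⊎ x ≺ y ⊎ y ≺ x

  comparable? : Decidable Comparable
  comparable? x y = (x ≟ y) ⊎-dec (x ≺? y) ⊎-dec (y ≺? x)

  comparable-sym : Symmetric Comparable
  comparable-sym (inj₁ x≡y) = inj₁ (sym x≡y)
  comparable-sym (inj₂ (inj₁ x≺y)) = inj₂ (inj₂ x≺y)
  comparable-sym (inj₂ (inj₂ y≺x)) = inj₂ (inj₁ y≺x)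

  Incomparable : Rel A 0ℓ
  Incomparable x y = ¬ Comparable x y

  incomparable-sym : Symmetric Incomparable
  incomparable-sym x≁y y~x = x≁y (comparable-sym y~x)

  record Antichain (S : List A) (m : ℕ) : Set where
    field
      members : List A
      members⊆ : members ⊆ S
      pairwise : AllPairs Incomparable members
      size : length members ≡ m

  record ChainCover (S : List A) (k : ℕ) : Set where
    field
      chain : A → ℕ
      chain< : ∀ {x} → x ∈ S → chain x < k
      sameChain⇒comparable : ∀ {x y} → x ∈ S → y ∈ S → chain x ≡ chain y → Comparable x y

  open Antichain
  open ChainCover

  antichain-⊆ : ∀ {S T m} → S ⊆ T → Antichain S m → Antichain T m
  antichain-⊆ S⊆T B = record
    { members = members B ; members⊆ = S⊆T ∘′ members⊆ B ; pairwise = pairwise B ; size = size B }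

  chainCover-⊆ : ∀ {S T k} → S ⊆ T → ChainCover T k → ChainCover S k
  chainCover-⊆ S⊆T C = record
    { chain = chain C
    ; chain< = chain< C ∘′ S⊆T
    ; sameChain⇒comparable = λ x∈ y∈ → sameChain⇒comparable C (S⊆T x∈) (S⊆T y∈)
    }

  module _ {S k m} (C : ChainCover S k) (B : Antichain S m) where

    antichain-chains-distinct : AllPairs (λ x y → chain C x ≢ chain C y) (members B)
    antichain-chains-distinct = AllPairs-map∈
      (λ x∈ y∈ x≁y same → x≁y (sameChain⇒comparable C (members⊆ B x∈) (members⊆ B y∈) same))
      (pairwise B)

    antichain-chains-bounded : All (λ x → chain C x < k) (members B)
    antichain-chains-bounded = All.tabulate (chain< C ∘′ members⊆ B)

  antichain≤chainCover : ∀ {S k} → ChainCover S k → ¬ Antichain S (suc k)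
  antichain≤chainCover C B = <-irrefl (size B) (s≤s
    (distinct-values⇒length≤ (chain C) (antichain-chains-bounded C B) (antichain-chains-distinct C B)))

  antichain-meets-every-chain : ∀ {S k} (C : ChainCover S k) (B : Antichain S k) →
    (i : Fin k) → ∃ λ x → x ∈ members B × chain C x ≡ toℕ i
  antichain-meets-every-chain C B i = find (distinct-values-exhaustive (chain C) (size B)
    (antichain-chains-bounded C B) (antichain-chains-distinct C B) i)

  addChain : ∀ {S R k} {P : A → Set} → Relation.Unary.Decidable P →
    (∀ {x y} → x ∈ S → y ∈ S → P x → P y → Comparable x y) →
    (∀ {x} → x ∈ S → ¬ P x → x ∈ R) → ChainCover R k → ChainCover S (suc k)
  addChain {S} {R} {k} {P} P? P-chain rest C = record
    { chain = chain′ ; chain< = chain′< ; sameChain⇒comparable = sameChain′ }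
    where
    chain′ : A → ℕ
    chain′ x with P? x
    ... | yes _ = k
    ... | no _ = chain C x
    chain′< : ∀ {x} → x ∈ S → chain′ x < suc k
    chain′< {x} x∈ with P? x
    ... | yes _ = ≤-refl
    ... | no ¬px = m<n⇒m<1+n (chain< C (rest x∈ ¬px))
    sameChain′ : ∀ {x y} → x ∈ S → y ∈ S → chain′ x ≡ chain′ y → Comparable x y
    sameChain′ {x} {y} x∈ y∈ same with P? x | P? y
    ... | yes px | yes py = P-chain x∈ y∈ px py
    ... | no ¬px | no ¬py = sameChain⇒comparable C (rest x∈ ¬px) (rest y∈ ¬py) same
    ... | yes _ | no ¬py = contradiction (chain< C (rest y∈ ¬py)) (<-irrefl (sym same))
    ... | no ¬px | yes _ = contradiction (chain< C (rest x∈ ¬px)) (<-irrefl same)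

  DilworthUpTo : ℕ → Set
  DilworthUpTo m = ∀ T → length T ≤ m → ∀ k → Antichain T (suc k) ⊎ ChainCover T k

  emptyAntichain : ∀ {S} → Antichain S 0
  emptyAntichain = record { members = [] ; members⊆ = λ () ; pairwise = [] ; size = refl }

  antichain? : ∀ {m} → DilworthUpTo m → ∀ T → length T ≤ m → ∀ j → Dec (Antichain T j)
  antichain? ih T len zero = yes emptyAntichain
  antichain? ih T len (suc j) with ih T len j
  ... | inj₁ B = yes B
  ... | inj₂ C = no (antichain≤chainCover C)

  ∈-∷-≢ : ∀ {a y : A} {S} → y ∈ a ∷ S → y ≢ a → y ∈ S
  ∈-∷-≢ (here y≡a) y≢a = contradiction y≡a y≢a
  ∈-∷-≢ (there y∈) _ = y∈

  -- The highest elements of the k+1 chains lying on maximum antichains form an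
  -- antichain; either a extends it, or a lies above the top of some chain i, and then that chain
  -- up to its top, together with a, can be split off: what remains has no antichain of size k+1.
  module AddMaximalTight {m} (ih : DilworthUpTo m) {a S} (a∉S : a ∉ S)
    (a-maximal : ∀ {y} → y ∈ S → ¬ a ≺ y) (len : length S ≤ m)
    {k} (C : ChainCover S (suc k)) (B₀ : Antichain S (suc k)) where

    OnMaxAntichain : A → Set
    OnMaxAntichain z = Σ (Antichain S (suc k)) λ B → z ∈ members B

    incomparablesOf : A → List A
    incomparablesOf z = filter (∁? (comparable? z)) S

    onMaxAntichain? : Relation.Unary.Decidable OnMaxAntichain
    onMaxAntichain? z = map′ extend restrict
      ((z ∈? S) ×-dec antichain? ih (incomparablesOf z) (≤-trans (length-filter _ S) len) k)
      where
      incomparables⁻ : ∀ {y} → y ∈ incomparablesOf z → y ∈ S × Incomparable z y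
      incomparables⁻ = ∈-filter⁻ (∁? (comparable? z)) {xs = S}
      extend : z ∈ S × Antichain (incomparablesOf z) k → OnMaxAntichain z
      extend (z∈ , B) = record
        { members = z ∷ members B
        ; members⊆ = λ { (here refl) → z∈ ; (there y∈) → proj₁ (incomparables⁻ (members⊆ B y∈)) }
        ; pairwise = All.tabulate (λ y∈ → proj₂ (incomparables⁻ (members⊆ B y∈))) ∷ pairwise B
        ; size = cong suc (size B)
        } , here refl
      restrict : OnMaxAntichain z → z ∈ S × Antichain (incomparablesOf z) k
      restrict (B , z∈B) with ys , len′ , ys⊆ , pys , z≁ys ← AllPairs-remove incomparable-sym z∈B (pairwise B) =
        members⊆ B z∈B , record
          { members = ys
          ; members⊆ = λ y∈ → ∈-filter⁺ (∁? (comparable? z)) (members⊆ B (ys⊆ y∈)) (All.lookup z≁ys y∈)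
          ; pairwise = pys
          ; size = suc-injective (trans len′ (size B))
          }

    Candidate : Fin (suc k) → A → Set
    Candidate i y = chain C y ≡ toℕ i × OnMaxAntichain y

    candidate? : ∀ i → Relation.Unary.Decidable (Candidate i)
    candidate? i y = (chain C y ℕ.≟ toℕ i) ×-dec onMaxAntichain? y

    candidates : Fin (suc k) → List A
    candidates i = filter (candidate? i) S

    candidates⁻ : ∀ {i y} → y ∈ candidates i → y ∈ S × Candidate i y
    candidates⁻ {i} = ∈-filter⁻ (candidate? i) {xs = S}

    candidates⁺ : ∀ {i y} → y ∈ S → Candidate i y → y ∈ candidates i
    candidates⁺ {i} = ∈-filter⁺ (candidate? i)

    candidate : (i : Fin (suc k)) → A
    candidate i = proj₁ (antichain-meets-every-chain C B₀ i)

    candidate∈ : ∀ i → candidate i ∈ candidates i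
    candidate∈ i with _ , y∈B₀ , same ← antichain-meets-every-chain C B₀ i =
      candidates⁺ (members⊆ B₀ y∈B₀) (same , B₀ , y∈B₀)

    top : Fin (suc k) → A
    top i = argmax rank (candidate i) (candidates i)

    top∈ : ∀ i → top i ∈ candidates i
    top∈ i = argmax-all rank (candidate∈ i) (All.tabulate id)

    top∈S : ∀ i → top i ∈ S
    top∈S i = proj₁ (candidates⁻ (top∈ i))

    top-chain : ∀ i → chain C (top i) ≡ toℕ i
    top-chain i = proj₁ (proj₂ (candidates⁻ (top∈ i)))

    top-highest : ∀ {i y} → y ∈ S → Candidate i y → y ≼ top i
    top-highest {i} {y} y∈ (same , onMax) with sameChain⇒comparable C y∈ (top∈S i) (trans same (sym (top-chain i)))
    ... | inj₁ y≡top = inj₁ y≡top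
    ... | inj₂ (inj₁ y≺top) = inj₂ y≺top
    ... | inj₂ (inj₂ top≺y) = contradiction
      (All.lookup (f[xs]≤f[argmax] (candidate i) (candidates i)) (candidates⁺ y∈ (same , onMax)))
      (<⇒≱ (≺⇒rank< top≺y))

    -- A maximum antichain through top j meets chain i below top i, so top i ⊀ top j.
    top-not-below : ∀ {i j} → i ≢ j → ¬ (top i ≺ top j)
    top-not-below {i} {j} i≢j top-i≺top-j
      with _ , _ , (B , top-j∈B) ← candidates⁻ (top∈ j)
      with y , y∈B , same ← antichain-meets-every-chain C B i
      = AllPairs-∈ incomparable-sym (pairwise B) y∈B top-j∈B y≢top-j
          (inj₂ (inj₁ (≼-≺-trans (top-highest (members⊆ B y∈B) (same , B , y∈B)) top-i≺top-j)))
      where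
      y≢top-j : y ≢ top j
      y≢top-j refl = i≢j (toℕ-injective (trans (sym same) (top-chain j)))

    tops-incomparable : ∀ {i j} → i ≢ j → Incomparable (top i) (top j)
    tops-incomparable {i} {j} i≢j (inj₁ top-i≡top-j) = i≢j (toℕ-injective (begin
      toℕ i            ≡⟨ sym (top-chain i) ⟩
      chain C (top i)  ≡⟨ cong (chain C) top-i≡top-j ⟩
      chain C (top j)  ≡⟨ top-chain j ⟩
      toℕ j            ∎))
      where open ≡-Reasoning
    tops-incomparable i≢j (inj₂ (inj₁ top-i≺top-j)) = top-not-below i≢j top-i≺top-j
    tops-incomparable i≢j (inj₂ (inj₂ top-j≺top-i)) = top-not-below (i≢j ∘′ sym) top-j≺top-i

    top≺a : ∀ i → Comparable a (top i) → top i ≺ a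
    top≺a i (inj₁ a≡top) = contradiction (subst (_∈ S) (sym a≡top) (top∈S i)) a∉S
    top≺a i (inj₂ (inj₁ a≺top)) = contradiction a≺top (a-maximal (top∈S i))
    top≺a i (inj₂ (inj₂ top≺a)) = top≺a

    antichain-with-a : (∀ i → Incomparable a (top i)) → Antichain (a ∷ S) (suc (suc k))
    antichain-with-a a≁tops = record
      { members = a ∷ tabulate top
      ; members⊆ = members⊆′
      ; pairwise = tabulate⁺ a≁tops ∷ AllPairs.tabulate⁺ tops-incomparable
      ; size = cong suc (length-tabulate top)
      }
      where
      members⊆′ : a ∷ tabulate top ⊆ a ∷ S
      members⊆′ (here refl) = here refl
      members⊆′ (there y∈) with i , refl ← ∈-tabulate⁻ {f = top} y∈ = there (top∈S i)

    module CutBelowTop (i : Fin (suc k)) (top≺a : top i ≺ a) where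

      Below : A → Set
      Below y = y ≡ a ⊎ (chain C y ≡ toℕ i × y ≼ top i)

      below? : Relation.Unary.Decidable Below
      below? y = (y ≟ a) ⊎-dec ((chain C y ℕ.≟ toℕ i) ×-dec ((y ≟ top i) ⊎-dec (y ≺? top i)))

      below-chain : ∀ {x y} → x ∈ a ∷ S → y ∈ a ∷ S → Below x → Below y → Comparable x y
      below-chain _ _ (inj₁ refl) (inj₁ refl) = inj₁ refl
      below-chain _ _ (inj₁ refl) (inj₂ (_ , y≼top)) = inj₂ (inj₂ (≼-≺-trans y≼top top≺a))
      below-chain _ _ (inj₂ (_ , x≼top)) (inj₁ refl) = inj₂ (inj₁ (≼-≺-trans x≼top top≺a))
      below-chain x∈ y∈ (inj₂ (x-same , x≼top)) (inj₂ (y-same , y≼top)) =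
        sameChain⇒comparable C (∈-∷-≢ x∈ (≺⇒≢a x≼top)) (∈-∷-≢ y∈ (≺⇒≢a y≼top)) (trans x-same (sym y-same))
        where
        ≺⇒≢a : ∀ {z} → z ≼ top i → z ≢ a
        ≺⇒≢a z≼top refl = <-irrefl refl (≺⇒rank< (≼-≺-trans z≼top top≺a))

      Rest : List A
      Rest = filter (∁? below?) S

      rest⁻ : ∀ {x} → x ∈ Rest → x ∈ S × ¬ Below x
      rest⁻ = ∈-filter⁻ (∁? below?) {xs = S}

      rest⁺ : ∀ {x} → x ∈ a ∷ S → ¬ Below x → x ∈ Rest
      rest⁺ x∈ ¬below = ∈-filter⁺ (∁? below?) (∈-∷-≢ x∈ (¬below ∘′ inj₁)) ¬below

      max-antichain-meets-Below : (B : Antichain S (suc k)) → ∃ λ y → y ∈ members B × Below y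
      max-antichain-meets-Below B with y , y∈B , same ← antichain-meets-every-chain C B i =
        y , y∈B , inj₂ (same , top-highest (members⊆ B y∈B) (same , B , y∈B))

      no-max-antichain-in-Rest : ¬ Antichain Rest (suc k)
      no-max-antichain-in-Rest B =
        let y , y∈B , below = max-antichain-meets-Below (antichain-⊆ (proj₁ ∘′ rest⁻) B)
        in proj₂ (rest⁻ (members⊆ B y∈B)) below

      cover : ChainCover (a ∷ S) (suc k)
      cover with ih Rest (≤-trans (length-filter _ S) len) k
      ... | inj₁ B = contradiction B no-max-antichain-in-Rest
      ... | inj₂ C′ = addChain below? below-chain rest⁺ C′

    result : Antichain (a ∷ S) (suc (suc k)) ⊎ ChainCover (a ∷ S) (suc k)
    result with any? (λ i → comparable? a (top i))
    ... | yes (i , a~top) = inj₂ (CutBelowTop.cover i (top≺a i a~top))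
    ... | no a≁tops = inj₁ (antichain-with-a (λ i a~top → a≁tops (i , a~top)))

  addMaximal : ∀ {m} → DilworthUpTo m → ∀ {a S} → a ∉ S → (∀ {y} → y ∈ S → ¬ a ≺ y) →
    length S ≤ m → ∀ k → Antichain (a ∷ S) (suc k) ⊎ ChainCover (a ∷ S) k
  addMaximal ih {a} a∉S a-maximal len zero = inj₁ record
    { members = a ∷ [] ; members⊆ = λ { (here refl) → here refl } ; pairwise = [] ∷ [] ; size = refl }
  addMaximal ih {a} {S} a∉S a-maximal len (suc k) with ih S len (suc k)
  ... | inj₁ B = inj₁ (antichain-⊆ there B)
  ... | inj₂ C with ih S len k
  ...   | inj₂ C′ = inj₂ (addChain (_≟ a) (λ { _ _ refl refl → inj₁ refl }) ∈-∷-≢ C′)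
  ...   | inj₁ B₀ = AddMaximalTight.result ih a∉S a-maximal len C B₀

  dilworth-upTo : ∀ m → DilworthUpTo m
  dilworth-upTo _ [] _ k = inj₂ record { chain = λ _ → 0 ; chain< = λ () ; sameChain⇒comparable = λ () }
  dilworth-upTo (suc m) S@(s ∷ _) len k =
    Sum.map (antichain-⊆ a∷S′⊆S) (chainCover-⊆ S⊆a∷S′) (addMaximal (dilworth-upTo m) a∉S′ a-maximal len′ k)
    where
    a : A
    a = argmax rank s S
    a∈S : a ∈ S
    a∈S = argmax-all rank (here refl) (All.tabulate id)
    S′ : List A
    S′ = filter (∁? (_≟ a)) S
    S′⁻ : ∀ {y} → y ∈ S′ → y ∈ S × y ≢ a
    S′⁻ = ∈-filter⁻ (∁? (_≟ a)) {xs = S}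
    a∉S′ : a ∉ S′
    a∉S′ a∈S′ = proj₂ (S′⁻ a∈S′) refl
    a-maximal : ∀ {y} → y ∈ S′ → ¬ a ≺ y
    a-maximal y∈ a≺y = <⇒≱ (≺⇒rank< a≺y) (All.lookup (f[xs]≤f[argmax] {f = rank} s S) (proj₁ (S′⁻ y∈)))
    len′ : length S′ ≤ m
    len′ = s≤s⁻¹ (≤-trans (filter-notAll (∁? (_≟ a)) S (Any.map (λ a≡y y≢a → y≢a (sym a≡y)) a∈S)) len)
    a∷S′⊆S : a ∷ S′ ⊆ S
    a∷S′⊆S (here refl) = a∈S
    a∷S′⊆S (there y∈) = proj₁ (S′⁻ y∈)
    S⊆a∷S′ : S ⊆ a ∷ S′
    S⊆a∷S′ {y} y∈ = byEquality (y ≟ a)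
      where
      byEquality : Dec (y ≡ a) → y ∈ a ∷ S′
      byEquality (yes y≡a) = here y≡a
      byEquality (no y≢a) = there (∈-filter⁺ (∁? (_≟ a)) y∈ y≢a)

  dilworth : ∀ S k → Antichain S (suc k) ⊎ ChainCover S k
  dilworth S = dilworth-upTo (length S) S ≤-refl

lookup-allFin : ∀ {n} i → lookup (allFin n) i ≡ cast (length-tabulate id) i
lookup-allFin {n} i = begin
  lookup (allFin n) i                                   ≡⟨ cong (lookup (allFin n)) (sym (cast-involutive (sym |allFin|) |allFin| i)) ⟩
  lookup (allFin n) (cast (sym |allFin|) (cast |allFin| i)) ≡⟨ lookup-tabulate id _ ⟩
  cast |allFin| i                                        ∎
  where
  open ≡-Reasoning
  |allFin| : length (allFin n) ≡ n
  |allFin| = length-tabulate id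

module _ {n} (key : Fin n → ℕ) where

  private
    byKey : DecTotalOrder _ _ _
    byKey = On.decTotalOrder ≤-decTotalOrder key
    open Sort byKey using (sort; sort-↭; sort-↗)

    sorted : List (Fin n)
    sorted = sort (allFin n)

    |allFin| : length (allFin n) ≡ n
    |allFin| = length-tabulate _

    |sorted| : length sorted ≡ n
    |sorted| = trans (↭-length (sort-↭ (allFin n))) |allFin|

  sortedByKey : Ordering n
  sortedByKey = cast-id (sym |sorted|) ∘ₚ onIndices (↭⇒↭ₛ (sort-↭ (allFin n))) ∘ₚ cast-id |allFin|

  at-sortedByKey : ∀ p → at sortedByKey p ≡ lookup sorted (cast (sym |sorted|) p)
  at-sortedByKey p = sym (trans (onIndices-lookup (setoid (Fin n)) (↭⇒↭ₛ (sort-↭ (allFin n))) _) (lookup-allFin _))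

  sortedByKey-monotone : ∀ {p q} → toℕ p ≤ toℕ q → key (at sortedByKey p) ≤ key (at sortedByKey q)
  sortedByKey-monotone {p} {q} p≤q rewrite at-sortedByKey p | at-sortedByKey q =
    lookup-mono-≤ (DecTotalOrder.totalOrder byKey) (sort-↗ (allFin n))
      (subst₂ _≤_ (sym (toℕ-cast _ p)) (sym (toℕ-cast _ q)) p≤q)

module _ {n} (σ : Ordering n) where

  position : Fin n → Fin n
  position = Inverse.from σ

  position-at : ∀ i → position (at σ i) ≡ i
  position-at = Inverse.strictlyInverseʳ σ

  at-position : ∀ v → at σ (position v) ≡ v
  at-position = Inverse.strictlyInverseˡ σ

  at-injective : ∀ {i j} → at σ i ≡ at σ j → i ≡ j
  at-injective {i} {j} eq = trans (sym (position-at i)) (trans (cong position eq) (position-at j))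

  <⇒at≢ : ∀ {i j} → toℕ i < toℕ j → at σ i ≢ at σ j
  <⇒at≢ i<j eq = <-irrefl (cong toℕ (at-injective eq)) i<j

module _ {n} (G : Graph n) where

  Edge-sym : ∀ {u v} → Edge G u v → Edge G v u
  Edge-sym {u} {v} e = trans (adj-sym G v u) e

  Edge⇒≢ : ∀ {u v} → Edge G u v → u ≢ v
  Edge⇒≢ {u} e refl with () ← trans (sym e) (adj-irrefl G u)

  complement-edge⁺ : ∀ {u v} → u ≢ v → adj G u v ≡ false → Edge (complement G) u v
  complement-edge⁺ {u} {v} u≢v nonadjacent with u Fin.≟ v
  ... | yes u≡v = contradiction u≡v u≢v
  ... | no _ rewrite nonadjacent = refl

  complement-edge⁻ : ∀ {u v} → Edge (complement G) u v → adj G u v ≡ false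
  complement-edge⁻ {u} {v} e with u Fin.≟ v
  ... | no _ with adj G u v
  ...   | false = refl

  thinLe-mono : ∀ {k k′} → k ≤ k′ → ThinLe G k → ThinLe G k′
  thinLe-mono k≤k′ (σ , P , consistent) =
    σ , (λ v → inject≤ (P v) k≤k′) , λ r s t r<s s<t same →
      consistent r s t r<s s<t (toℕ-injective (trans (sym (toℕ-inject≤ _ k≤k′)) (trans (cong toℕ same) (toℕ-inject≤ _ k≤k′))))

  -- With at most two vertices there are no positions r < s < t.
  thinLe-1-of-≤2 : n ≤ 2 → ThinLe G 1
  thinLe-1-of-≤2 n≤2 = Permutation.id , (λ _ → Fin.zero) , λ r s t r<s s<t _ _ →
    contradiction (≤-trans (s≤s (≤-trans (s≤s z≤n) r<s)) s<t) (<⇒≱ (≤-trans (toℕ<n t) n≤2))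

  IsClique : List (Fin n) → Set
  IsClique = AllPairs (Edge G)

module CoComparability {n} {G : Graph n} (coComparable : IsCoComparability G) where

  σ : Ordering n
  σ = proj₁ coComparable

  -- Positions, ordered by the transitive orientation of the complement that σ provides.
  _≺_ : Rel (Fin n) 0ℓ
  i ≺ j = toℕ i < toℕ j × adj G (at σ i) (at σ j) ≡ false

  _≺?_ : Decidable _≺_
  i ≺? j = (toℕ i ℕ.<? toℕ j) ×-dec (adj G (at σ i) (at σ j) Bool.≟ false)

  ≺-trans : Transitive _≺_
  ≺-trans {i} {j} {k} (i<j , i≁j) (j<k , j≁k) = <-trans i<j j<k ,
    complement-edge⁻ G (proj₂ coComparable i j k i<j j<k
      (complement-edge⁺ G (<⇒at≢ σ i<j) i≁j) (complement-edge⁺ G (<⇒at≢ σ j<k) j≁k))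

  open Dilworth Fin._≟_ _≺?_ ≺-trans toℕ proj₁ public

  incomparable⇒edge : ∀ {i j} → Incomparable i j → Edge G (at σ i) (at σ j)
  incomparable⇒edge {i} {j} i≁j with <-cmp (toℕ i) (toℕ j)
  ... | tri< i<j _ _ = ¬-not (λ i≁j′ → i≁j (inj₂ (inj₁ (i<j , i≁j′))))
  ... | tri≈ _ i≡j _ = contradiction (inj₁ (toℕ-injective i≡j)) i≁j
  ... | tri> _ _ j<i = ¬-not (λ i≁j′ → i≁j (inj₂ (inj₂ (j<i , trans (adj-sym G _ _) i≁j′))))

  antichain⇒clique : ∀ {S m} (B : Antichain S m) → IsClique G (map (at σ) (Antichain.members B))
  antichain⇒clique B = AllPairs.map⁺ (AllPairs.map incomparable⇒edge (Antichain.pairwise B))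

  chainCover⇒thinLe : ∀ {k} → ChainCover (allFin n) k → ThinLe G k
  chainCover⇒thinLe {k} C = σ , label , consistent
    where
    open ChainCover C
    label : Fin n → Fin k
    label v = fromℕ< (chain< (∈-allFin (position σ v)))
    label-at : ∀ p → toℕ (label (at σ p)) ≡ chain p
    label-at p = trans (toℕ-fromℕ< _) (cong chain (position-at σ p))
    consistent : Consistent G σ label
    consistent r s t r<s s<t same t~r
      with sameChain⇒comparable (∈-allFin r) (∈-allFin s) (trans (sym (label-at r)) (trans (cong toℕ same) (label-at s)))
    ... | inj₁ refl = contradiction r<s (<-irrefl refl)
    ... | inj₂ (inj₂ (s<r , _)) = contradiction r<s (<-asym s<r)
    ... | inj₂ (inj₁ r≺s) = ¬-not λ t≁s →
      not-¬ t~r (trans (adj-sym G _ _) (proj₂ (≺-trans r≺s (s<t , trans (adj-sym G _ _) t≁s))))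

distinct⇒length≤ : ∀ {n} {xs : List (Fin n)} → AllPairs _≢_ xs → length xs ≤ n
distinct⇒length≤ distinct = distinct-values⇒length≤ toℕ (All.tabulate (λ {x} _ → toℕ<n x))
  (AllPairs.map (_∘′ toℕ-injective) distinct)

module _ {n : ℕ} where

  open import Data.List.Membership.DecPropositional (Fin._≟_ {n}) using (_∈?_)

  ∃-∉ : (xs : List (Fin n)) → length xs < n → ∃ λ v → v ∉ xs
  ∃-∉ xs short with any? (∁? (_∈? xs))
  ... | yes found = found
  ... | no none = contradiction (injective⇒≤ index-injective) (<⇒≱ short)
    where
    everywhere : ∀ v → v ∈ xs
    everywhere v = decidable-stable (v ∈? xs) (λ v∉ → none (v , v∉))
    index-injective : ∀ {u v} → Any.index (everywhere u) ≡ Any.index (everywhere v) → u ≡ v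
    index-injective {u} {v} eq = trans (lookup-index (everywhere u))
      (trans (cong (lookup xs) eq) (sym (lookup-index (everywhere v))))

-- Thinness from a clique

module CliqueBound {n} (G : Graph n) {C : List (Fin n)} (clique : IsClique G C) {b : Fin n} (b∉C : b ∉ C) where

  open import Data.List.Membership.DecPropositional (Fin._≟_ {n}) using (_∈?_)

  key : Fin n → ℕ
  key v with v ∈? b ∷ C
  ... | no _ = 0
  ... | yes (here _) = 3
  ... | yes (there _) = if adj G b v then 2 else 1

  key-outsider : ∀ {v} → v ∉ b ∷ C → key v ≡ 0
  key-outsider {v} v∉ with v ∈? b ∷ C
  ... | yes v∈ = contradiction v∈ v∉
  ... | no _ = refl

  key≡0⇒outsider : ∀ {v} → key v ≡ 0 → v ∉ b ∷ C
  key≡0⇒outsider {v} key≡0 with v ∈? b ∷ C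
  ... | no v∉ = v∉
  ... | yes (there _) with adj G b v
  ...   | true with () ← key≡0
  ...   | false with () ← key≡0

  key-b : key b ≡ 3
  key-b with b ∈? b ∷ C
  ... | yes (here _) = refl
  ... | yes (there b∈C) = contradiction b∈C b∉C
  ... | no b∉ = contradiction (here refl) b∉

  key-C≤2 : ∀ {v} → v ∈ C → key v ≤ 2
  key-C≤2 {v} v∈C with v ∈? b ∷ C
  ... | no v∉ = z≤n
  ... | yes (here refl) = contradiction v∈C b∉C
  ... | yes (there _) with adj G b v
  ...   | true = ≤-refl
  ...   | false = s≤s z≤n

  key-neighbour : ∀ {v} → v ∈ C → Edge G b v → key v ≡ 2
  key-neighbour {v} v∈C b~v with v ∈? b ∷ C
  ... | no v∉ = contradiction (there v∈C) v∉
  ... | yes (here refl) = contradiction v∈C b∉C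
  ... | yes (there _) rewrite b~v = refl

  key≥2⇒neighbour : ∀ {v} → v ∈ C → 2 ≤ key v → Edge G b v
  key≥2⇒neighbour {v} v∈C 2≤key with v ∈? b ∷ C
  ... | no v∉ = contradiction (there v∈C) v∉
  ... | yes (here refl) = contradiction v∈C b∉C
  ... | yes (there _) with adj G b v
  ...   | true = refl
  ...   | false with s≤s () ← 2≤key

  abstract
    τ : Ordering n
    τ = sortedByKey key

    key-monotone : ∀ {p q} → toℕ p ≤ toℕ q → key (at τ p) ≤ key (at τ q)
    key-monotone = sortedByKey-monotone key

  members-distinct : AllPairs _≢_ (b ∷ C)
  members-distinct = All.tabulate (λ v∈C b≡v → b∉C (subst (_∈ C) (sym b≡v) v∈C)) ∷ AllPairs.map (Edge⇒≢ G) clique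

  C<n : length C < n
  C<n = distinct⇒length≤ members-distinct

  -- The vertices up to an outsider's position are outsiders, and they are distinct from b ∷ C.
  outsider-position< : ∀ {v} → v ∉ b ∷ C → suc (toℕ (position τ v)) < n ∸ length C
  outsider-position< {v} v∉ = m+n≤o⇒m≤o∸n (suc (suc p)) (begin
    suc (suc p) + length C          ≡⟨ sym (+-suc (suc p) (length C)) ⟩
    suc p + suc (length C)          ≡⟨ sym (cong₂ _+_ (length-tabulate prefixAt) refl) ⟩
    length prefix + length (b ∷ C)  ≡⟨ sym (length-++ prefix) ⟩
    length (prefix ++ b ∷ C)        ≤⟨ distinct⇒length≤ (AllPairs.++⁺ prefix-distinct members-distinct prefix-outside) ⟩
    n                               ∎)
    where
    open ≤-Reasoning
    p : ℕ
    p = toℕ (position τ v)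
    p<n : suc p ≤ n
    p<n = toℕ<n (position τ v)
    prefixAt : Fin (suc p) → Fin n
    prefixAt q = at τ (inject≤ q p<n)
    prefix : List (Fin n)
    prefix = tabulate prefixAt
    prefix-distinct : AllPairs _≢_ prefix
    prefix-distinct = AllPairs.tabulate⁺ (λ q≢q′ eq → q≢q′ (inject≤-injective p<n p<n _ _ (at-injective τ eq)))
    prefix-outsider : ∀ q → prefixAt q ∉ b ∷ C
    prefix-outsider q = key≡0⇒outsider (n≤0⇒n≡0 (begin
      key (prefixAt q)              ≤⟨ key-monotone (subst (_≤ p) (sym (toℕ-inject≤ q p<n)) (s≤s⁻¹ (toℕ<n q))) ⟩
      key (at τ (position τ v))     ≡⟨ cong key (at-position τ v) ⟩
      key v                         ≡⟨ key-outsider v∉ ⟩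
      0                             ∎))
    prefix-outside : All (λ u → All (u ≢_) (b ∷ C)) prefix
    prefix-outside = tabulate⁺ (λ q → All.tabulate (λ w∈ u≡w → prefix-outsider q (subst (_∈ b ∷ C) (sym u≡w) w∈)))

  member-monotone : ∀ {p q} → toℕ p ≤ toℕ q → at τ p ∈ b ∷ C → at τ q ∈ b ∷ C
  member-monotone {p} p≤q p∈ = decidable-stable (_ ∈? _) λ q∉ →
    key≡0⇒outsider (n≤0⇒n≡0 (subst (key (at τ p) ≤_) (key-outsider q∉) (key-monotone p≤q))) p∈

  members-consistent : ∀ {r s t} → toℕ r < toℕ s → toℕ s < toℕ t → at τ r ∈ b ∷ C → at τ s ∈ b ∷ C →
    Edge G (at τ t) (at τ r) → Edge G (at τ t) (at τ s)
  members-consistent {r} {s} {t} r<s s<t r∈ s∈ t~r with member-monotone (<⇒≤ s<t) s∈ | s∈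
  ... | there t∈C | there s∈C = AllPairs-∈ (Edge-sym G) clique t∈C s∈C (<⇒at≢ τ s<t ∘′ sym)
  ... | there t∈C | here s≡b = contradiction (key-monotone (<⇒≤ s<t))
    (<⇒≱ (≤-<-trans (key-C≤2 t∈C) (subst (2 <_) (sym (trans (cong key s≡b) key-b)) ≤-refl)))
  ... | here t≡b | here s≡b = contradiction (trans s≡b (sym t≡b)) (<⇒at≢ τ s<t)
  ... | here t≡b | there s∈C with r∈
  ...   | here r≡b = contradiction (trans r≡b (sym t≡b)) (<⇒at≢ τ (<-trans r<s s<t))
  ...   | there r∈C = subst (λ u → Edge G u (at τ s)) (sym t≡b) (key≥2⇒neighbour s∈C (begin
          2                ≡⟨ sym (key-neighbour r∈C (subst (λ u → Edge G u (at τ r)) t≡b t~r)) ⟩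
          key (at τ r)     ≤⟨ key-monotone (<⇒≤ r<s) ⟩
          key (at τ s)     ∎))
    where open ≤-Reasoning

  label : Fin n → Fin (n ∸ length C)
  label v with v ∈? b ∷ C
  ... | yes _ = fromℕ< (m<n⇒0<n∸m C<n)
  ... | no v∉ = fromℕ< (outsider-position< v∉)

  label-member : ∀ {v} → v ∈ b ∷ C → toℕ (label v) ≡ 0
  label-member {v} v∈ with v ∈? b ∷ C
  ... | yes _ = toℕ-fromℕ< _
  ... | no v∉ = contradiction v∈ v∉

  label-outsider : ∀ {v} → v ∉ b ∷ C → toℕ (label v) ≡ suc (toℕ (position τ v))
  label-outsider {v} v∉ with v ∈? b ∷ C
  ... | yes v∈ = contradiction v∈ v∉
  ... | no _ = toℕ-fromℕ< _

  consistent : Consistent G τ label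
  consistent r s t r<s s<t same t~r = byMembership (at τ r ∈? b ∷ C) (at τ s ∈? b ∷ C)
    where
    same′ : toℕ (label (at τ r)) ≡ toℕ (label (at τ s))
    same′ = cong toℕ same
    byMembership : Dec (at τ r ∈ b ∷ C) → Dec (at τ s ∈ b ∷ C) → Edge G (at τ t) (at τ s)
    byMembership (yes r∈) (yes s∈) = members-consistent r<s s<t r∈ s∈ t~r
    byMembership (yes r∈) (no s∉) = contradiction (member-monotone (<⇒≤ r<s) r∈) s∉
    byMembership (no r∉) (yes s∈) = contradiction (trans (sym (label-outsider r∉)) (trans same′ (label-member s∈))) 1+n≢0
    byMembership (no r∉) (no s∉) = contradiction r<s (<-irrefl (cong toℕ (begin
      r                        ≡⟨ sym (position-at τ r) ⟩
      position τ (at τ r)      ≡⟨ toℕ-injective (suc-injective (trans (sym (label-outsider r∉)) (trans same′ (label-outsider s∉)))) ⟩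
      position τ (at τ s)      ≡⟨ position-at τ s ⟩
      s                        ∎)))
      where open ≡-Reasoning

  thinLe : ThinLe G (n ∸ length C)
  thinLe = τ , label , consistent

clique⇒thinLe : ∀ {n} (G : Graph n) {C} → IsClique G C → length C < n → ThinLe G (n ∸ length C)
clique⇒thinLe G {C} clique C<n with b , b∉C ← ∃-∉ C C<n = CliqueBound.thinLe G clique b∉C

2*⌊n/2⌋≤n : ∀ n → 2 * ⌊ n /2⌋ ≤ n
2*⌊n/2⌋≤n n = begin
  2 * ⌊ n /2⌋          ≡⟨ cong (⌊ n /2⌋ +_) (+-identityʳ ⌊ n /2⌋) ⟩
  ⌊ n /2⌋ + ⌊ n /2⌋    ≤⟨ +-monoʳ-≤ ⌊ n /2⌋ (⌊n/2⌋≤⌈n/2⌉ n) ⟩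
  ⌊ n /2⌋ + ⌈ n /2⌉    ≡⟨ ⌊n/2⌋+⌈n/2⌉≡n n ⟩
  n                    ∎
  where open ≤-Reasoning

⌈n/2⌉≤1+⌊n/2⌋ : ∀ n → ⌈ n /2⌉ ≤ suc ⌊ n /2⌋
⌈n/2⌉≤1+⌊n/2⌋ zero = z≤n
⌈n/2⌉≤1+⌊n/2⌋ (suc zero) = ≤-refl
⌈n/2⌉≤1+⌊n/2⌋ (suc (suc n)) = s≤s (⌈n/2⌉≤1+⌊n/2⌋ n)

n∸1+⌊n/2⌋≤⌊n/2⌋ : ∀ n → n ∸ suc ⌊ n /2⌋ ≤ ⌊ n /2⌋
n∸1+⌊n/2⌋≤⌊n/2⌋ n = m≤n+o⇒m∸n≤o n (suc ⌊ n /2⌋) (begin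
  n                    ≡⟨ sym (⌊n/2⌋+⌈n/2⌉≡n n) ⟩
  ⌊ n /2⌋ + ⌈ n /2⌉    ≤⟨ +-monoʳ-≤ ⌊ n /2⌋ (⌈n/2⌉≤1+⌊n/2⌋ n) ⟩
  ⌊ n /2⌋ + suc ⌊ n /2⌋ ≡⟨ +-comm ⌊ n /2⌋ _ ⟩
  suc ⌊ n /2⌋ + ⌊ n /2⌋ ∎)
  where open ≤-Reasoning

1+⌊n/2⌋<n : ∀ {n} → 3 ≤ n → suc ⌊ n /2⌋ < n
1+⌊n/2⌋<n {suc zero} (s≤s ())
1+⌊n/2⌋<n {suc (suc zero)} (s≤s (s≤s ()))
1+⌊n/2⌋<n {suc (suc (suc n))} _ = s≤s (s≤s (s≤s (s≤s⁻¹ (⌊n/2⌋<n n))))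

theorem3p21 : ∀ {n} (G : Graph n) → 2 ≤ n → IsCoComparability G →
    Σ ℕ λ k → (2 * k ≤ n) × ThinLe G k
theorem3p21 {n} G 2≤n coComparable with n ℕ.≤? 2
... | yes n≤2 = 1 , 2≤n , thinLe-1-of-≤2 G n≤2
... | no n≰2 = ⌊ n /2⌋ , 2*⌊n/2⌋≤n n , byDilworth (dilworth (allFin n) ⌊ n /2⌋)
  where
  open CoComparability coComparable
  byDilworth : Antichain (allFin n) (suc ⌊ n /2⌋) ⊎ ChainCover (allFin n) ⌊ n /2⌋ → ThinLe G ⌊ n /2⌋
  byDilworth (inj₂ cover) = chainCover⇒thinLe cover
  byDilworth (inj₁ B) = thinLe-mono G (subst (λ c → n ∸ c ≤ ⌊ n /2⌋) (sym |clique|) (n∸1+⌊n/2⌋≤⌊n/2⌋ n))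
    (clique⇒thinLe G (antichain⇒clique B) (subst (_< n) (sym |clique|) (1+⌊n/2⌋<n (≰⇒> n≰2))))
    where
    |clique| : length (map (at σ) (Antichain.members B)) ≡ suc ⌊ n /2⌋
    |clique| = trans (length-map (at σ) (Antichain.members B)) (Antichain.size B)
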